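{- There is a constant $D$ such that for any positive integer $n$ there exists a connected graph $G$ with $\Delta(G)\le D$ and $\mathrm{def}_c(G)\ge n$.
   Context: All graphs are finite, simple and undirected. A proper $t$-edge coloring of $G$ is a map $\alpha:E(G)\to\{1,\dots,t\}$ giving adjacent edges distinct colors. A set $A\subseteq\{1,\dots,t\}$ is a cyclic interval modulo $t$ if $A$ or $\{1,\dots,t\}\setminus A$ is an interval of integers; a cyclic interval $t$-coloring is a proper $t$-edge coloring in which the set of colors at every vertex is a cyclic interval modulo $t$. The cyclic deficiency $\mathrm{def}_c(G)$ is the minimum number of pendant edges whose attachment to $G$ yields a graph admitting a cyclic interval coloring. $\Delta(G)$ is the maximum degree. -}

module Defs where

open import Data.Nat using (ℕ; zero; suc; _+_; _≤_; _<_)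
open import Data.Fin using (Fin; toℕ; splitAt; _≟_)
import Data.Fin as F
open import Data.Bool using (Bool; true; false; T; if_then_else_)
open import Data.Sum using (_⊎_; inj₁; inj₂)
open import Data.Product using (Σ; ∃; _×_; _,_)
open import Data.List using (List; map; allFin)
open import Data.Nat.ListAction using (sum)
open import Relation.Nullary using (¬_; does)
open import Relation.Binary.PropositionalEquality using (_≡_; refl)

record Graph : Set where
  field
    V     : ℕ
    adj   : Fin V → Fin V → Bool
    sym   : ∀ u v → adj u v ≡ adj v u
    irrefl : ∀ v → adj v v ≡ false

open Graph public

E : (G : Graph) → Fin (V G) → Fin (V G) → Set
E G u v = T (adj G u v)

degree : (G : Graph) → Fin (V G) → ℕ
degree G v = sum (map (λ u → if adj G v u then 1 else 0) (allFin (V G)))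

MaxDegreeAtMost : Graph → ℕ → Set
MaxDegreeAtMost G D = ∀ v → degree G v ≤ D

data Walk (G : Graph) : Fin (V G) → Fin (V G) → Set where
  here : ∀ {v} → Walk G v v
  step : ∀ {u w v} → E G u w → Walk G w v → Walk G u v

Connected : Graph → Set
Connected G = ∀ u v → Walk G u v

-- Attaching k pendant edges: new vertices Fin k (placed after the old ones),
-- the j-th new vertex is a leaf adjacent exactly to f j.
module _ (n k : ℕ) (f : Fin k → Fin n) (adj₀ : Fin n → Fin n → Bool) where
  adj⊎ : Fin n ⊎ Fin k → Fin n ⊎ Fin k → Bool
  adj⊎ (inj₁ u) (inj₁ v) = adj₀ u v
  adj⊎ (inj₁ u) (inj₂ j) = does (u ≟ f j)
  adj⊎ (inj₂ j) (inj₁ u) = does (u ≟ f j)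
  adj⊎ (inj₂ i) (inj₂ j) = false

adj⊎-sym : ∀ n k f adj₀ → (∀ u v → adj₀ u v ≡ adj₀ v u) →
           ∀ a b → adj⊎ n k f adj₀ a b ≡ adj⊎ n k f adj₀ b a
adj⊎-sym n k f adj₀ s (inj₁ u) (inj₁ v) = s u v
adj⊎-sym n k f adj₀ s (inj₁ u) (inj₂ j) = refl
adj⊎-sym n k f adj₀ s (inj₂ j) (inj₁ u) = refl
adj⊎-sym n k f adj₀ s (inj₂ i) (inj₂ j) = refl

adj⊎-irr : ∀ n k f adj₀ → (∀ v → adj₀ v v ≡ false) →
           ∀ a → adj⊎ n k f adj₀ a a ≡ false
adj⊎-irr n k f adj₀ r (inj₁ u) = r u
adj⊎-irr n k f adj₀ r (inj₂ j) = refl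

attach : (G : Graph) (k : ℕ) → (Fin k → Fin (V G)) → Graph
attach G k f = record
  { V = V G + k
  ; adj = λ x y → adj⊎ (V G) k f (adj G) (splitAt (V G) x) (splitAt (V G) y)
  ; sym = λ x y → adj⊎-sym (V G) k f (adj G) (sym G) (splitAt (V G) x) (splitAt (V G) y)
  ; irrefl = λ x → adj⊎-irr (V G) k f (adj G) (irrefl G) (splitAt (V G) x)
  }

-- Colours {1,…,t} are represented by Fin t (colour i+1 ↦ i).
-- A subset of {1..t} is an interval of integers iff it is convex.
Interval : {t : ℕ} → (Fin t → Set) → Set
Interval {t} S = ∀ (i j l : Fin t) → toℕ i ≤ toℕ j → toℕ j ≤ toℕ l → S i → S l → S j

CyclicInterval : {t : ℕ} → (Fin t → Set) → Set
CyclicInterval S = Interval S ⊎ Interval (λ i → ¬ S i)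

record ProperEdgeColoring (G : Graph) (t : ℕ) : Set where
  field
    col      : Fin (V G) → Fin (V G) → Fin t
    col-sym  : ∀ u v → E G u v → col u v ≡ col v u
    proper   : ∀ v u w → E G v u → E G v w → col v u ≡ col v w → u ≡ w

open ProperEdgeColoring public

ColorsAt : {G : Graph} {t : ℕ} → ProperEdgeColoring G t → Fin (V G) → Fin t → Set
ColorsAt {G} α v i = ∃ λ u → E G v u × col α v u ≡ i

IsCyclicIntervalColoring : {G : Graph} {t : ℕ} → ProperEdgeColoring G t → Set
IsCyclicIntervalColoring {G} α = ∀ v → CyclicInterval (ColorsAt α v)

HasCyclicIntervalColoring : Graph → Set
HasCyclicIntervalColoring G =
  Σ ℕ λ t → Σ (ProperEdgeColoring G t) λ α → IsCyclicIntervalColoring α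

DefcAtLeast : Graph → ℕ → Set
DefcAtLeast G n = ∀ k → k < n → (f : Fin k → Fin (V G)) →
                  ¬ HasCyclicIntervalColoring (attach G k f)

-- Each block of the graph is the gadget on a, b, c, d, x with edges ab, ac, ad, bc, bd, cx, dx,
-- whose vertex x is joined to a hub carrying ten further leaves; the hubs of consecutive blocks form
-- a path, so the maximum degree is 13. Fewer pendant edges than blocks leave some block untouched.
-- In a cyclic interval t-colouring the hub forces t ≥ 11, and at each of a, b, c, d, x the three
-- colours form a cyclic interval, so any two of them differ by ±1 or ±2 modulo t. Writing every
-- colour of the gadget as the colour of ab plus an offset of absolute value at most 4, the bound
-- t ≥ 11 turns these congruences into equations between integers, and an exhaustive check of the
-- 4⁶ offset patterns shows that they have no solution.

module Submission where

open import Defs hiding (sym)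
open import Data.Nat as ℕ using (ℕ; zero; suc; _≤_; _<_; _≤?_; z≤n; s≤s; z<s)
import Data.Nat.Properties as ℕP
open import Data.Nat.ListAction using (sum)
open import Data.Integer as ℤ using (ℤ; +_; ∣_∣)
open import Data.Fin as F using (Fin; toℕ; fromℕ<; combine; remQuot; splitAt; _↑ˡ_; _↑ʳ_)
open import Data.Fin.Patterns using (0F; 1F; 2F; 3F)
import Data.Fin.Properties as FP
open import Data.Bool as Bool using (Bool; true; false; T; if_then_else_; _∧_; _∨_)
open import Data.Bool.Properties using (∨-comm; T-∧; T-∨)
open import Data.List using (List; []; _∷_; _++_; map; allFin; tabulate; length; filter)
open import Data.List.Properties using (map-tabulate; length-map; length-++)
open import Data.List.Membership.Propositional using (_∈_)
open import Data.List.Membership.Propositional.Properties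
  using (∈-allFin; ∈-map⁺; ∈-++⁺ˡ; ∈-++⁺ʳ; ∈-filter⁺)
open import Data.List.Relation.Unary.Any using (here; there)
open import Data.List.Relation.Unary.All as All using (All; []; _∷_)
open import Data.Vec using (_∷_; []; lookup)
open import Data.Product using (Σ; ∃; _×_; _,_; proj₁; proj₂; uncurry)
open import Data.Sum as Sum using (_⊎_; inj₁; inj₂; [_,_]′)
open import Data.Empty using (⊥; ⊥-elim)
open import Data.Unit using (tt)
open import Function using (_∘_; Equivalence)
open import Relation.Nullary using (¬_; Dec; yes; no; does; ¬?)
open import Relation.Nullary.Decidable as Dec using (toWitness; True; T?; _×-dec_; _⊎-dec_; _→-dec_)
open import Relation.Binary.Definitions using (tri<; tri≈; tri>)
open import Relation.Binary.PropositionalEquality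

module IntegerColours where

  open import Data.Nat.Divisibility as ℕ∣ using (>⇒∤)
  open import Data.Integer using (_+_; _-_; -_; 0ℤ)
  import Data.Integer.Properties as ℤP
  open import Data.Integer.Divisibility.Signed using (_∣_; divides; ∣⇒∣ᵤ; ∣m∣n⇒∣m+n; ∣m⇒∣-m)
  open import Data.Integer.Tactic.RingSolver using (solve-∀)
  open import Relation.Binary.Bundles using (Setoid)
  import Relation.Binary.Reasoning.Setoid as SetoidReasoning
  open import Level using (0ℓ)

  infix 4 _≡_mod_

  record _≡_mod_ (x y : ℤ) (t : ℕ) : Set where
    constructor congruent
    field modulus∣difference : + t ∣ x - y

  module _ {t : ℕ} where

    ≡⇒≡-mod : ∀ {x y} → x ≡ y → x ≡ y mod t
    ≡⇒≡-mod {x} refl = congruent (divides 0ℤ (trans (ℤP.+-inverseʳ x) (sym (ℤP.*-zeroˡ (+ t)))))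

    mod-sym : ∀ {x y} → x ≡ y mod t → y ≡ x mod t
    mod-sym {x} {y} (congruent t∣x-y) = congruent (subst (+ t ∣_) (flip x y) (∣m⇒∣-m t∣x-y))
      where
      flip : ∀ x y → - (x - y) ≡ y - x
      flip = solve-∀

    mod-trans : ∀ {x y z} → x ≡ y mod t → y ≡ z mod t → x ≡ z mod t
    mod-trans {x} {y} {z} (congruent t∣x-y) (congruent t∣y-z) =
      congruent (subst (+ t ∣_) (telescope x y z) (∣m∣n⇒∣m+n t∣x-y t∣y-z))
      where
      telescope : ∀ x y z → (x - y) + (y - z) ≡ x - z
      telescope = solve-∀

    mod-+ʳ : ∀ {x y} a → x ≡ y mod t → x + a ≡ y + a mod t
    mod-+ʳ {x} {y} a (congruent t∣x-y) = congruent (subst (+ t ∣_) (cancel x y a) t∣x-y)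
      where
      cancel : ∀ x y a → x - y ≡ (x + a) - (y + a)
      cancel = solve-∀

    mod-cancelˡ : ∀ {x y} c → c + x ≡ c + y mod t → x ≡ y mod t
    mod-cancelˡ {x} {y} c (congruent t∣c+x-c+y) = congruent (subst (+ t ∣_) (cancel x y c) t∣c+x-c+y)
      where
      cancel : ∀ x y c → (c + x) - (c + y) ≡ x - y
      cancel = solve-∀

    +t≡-mod : ∀ x → x + + t ≡ x mod t
    +t≡-mod x = congruent (divides (+ 1) (trans (cancel x (+ t)) (sym (ℤP.*-identityˡ (+ t)))))
      where
      cancel : ∀ x s → (x + s) - x ≡ s
      cancel = solve-∀

    mod-small⇒≡ : ∀ {x y} → x ≡ y mod t → ∣ x - y ∣ ℕ.< t → x ≡ y
    mod-small⇒≡ {x} {y} (congruent t∣x-y) small with ∣ x - y ∣ in eq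
    ... | zero  = ℤP.i-j≡0⇒i≡j x y (ℤP.∣i∣≡0⇒i≡0 eq)
    ... | suc _ = ⊥-elim (>⇒∤ small (subst (t ℕ∣.∣_) eq (∣⇒∣ᵤ t∣x-y)))

  shift : Fin 4 → ℤ
  shift 0F = + 1
  shift 1F = + 2
  shift 2F = - + 1
  shift 3F = - + 2

  opposite : Fin 4 → Fin 4
  opposite 0F = 2F
  opposite 1F = 3F
  opposite 2F = 0F
  opposite 3F = 1F

  shift-opposite : ∀ d → shift (opposite d) ≡ - shift d
  shift-opposite 0F = refl
  shift-opposite 1F = refl
  shift-opposite 2F = refl
  shift-opposite 3F = refl

  ∣shift∣≤2 : ∀ d → ∣ shift d ∣ ℕ.≤ 2
  ∣shift∣≤2 0F = s≤s z≤n
  ∣shift∣≤2 1F = ℕP.≤-refl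
  ∣shift∣≤2 2F = s≤s z≤n
  ∣shift∣≤2 3F = ℕP.≤-refl

  record Near (x y : ℤ) : Set where
    constructor near
    field
      offset   : Fin 4
      equality : y ≡ x + shift offset

  near? : ∀ x y → Dec (Near x y)
  near? x y = Dec.map′ (uncurry near) (λ (near d eq) → d , eq) (FP.any? λ d → y ℤ.≟ x + shift d)

  record Close (t : ℕ) (x y : ℤ) : Set where
    constructor close
    field
      offset     : Fin 4
      congruence : y ≡ x + shift offset mod t

  Triangle : ℕ → ℤ → ℤ → ℤ → Set
  Triangle t x y z = Close t x y × Close t x z × Close t y z

  mod-setoid : ℕ → Setoid 0ℓ 0ℓ
  mod-setoid t = record
    { Carrier = ℤ
    ; _≈_ = _≡_mod t
    ; isEquivalence = record { refl = ≡⇒≡-mod refl ; sym = mod-sym ; trans = mod-trans } }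

  close-sym : ∀ {t x y} → Close t x y → Close t y x
  close-sym {t} {x} {y} (close d y≈x+d) = close (opposite d) (begin
    x                                  ≡⟨ undo x (shift d) ⟨
    x + shift d + - shift d            ≡⟨ cong (_+_ (x + shift d)) (shift-opposite d) ⟨
    x + shift d + shift (opposite d)   ≈⟨ mod-+ʳ (shift (opposite d)) (mod-sym y≈x+d) ⟩
    y + shift (opposite d)             ∎)
    where
    open SetoidReasoning (mod-setoid t)
    undo : ∀ x s → x + s + - s ≡ x
    undo = solve-∀

  module _ {t : ℕ} where

    offset-step : ∀ {x y} c K s → x ≡ c + K mod t → y ≡ x + s mod t → y ≡ c + (K + s) mod t
    offset-step {x} {y} c K s x≈c+K y≈x+s = begin
      y              ≈⟨ y≈x+s ⟩
      x + s          ≈⟨ mod-+ʳ s x≈c+K ⟩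
      c + K + s      ≡⟨ ℤP.+-assoc c K s ⟩
      c + (K + s)    ∎
      where open SetoidReasoning (mod-setoid t)

    close⇒near : ∀ {x y K L} → 11 ℕ.≤ t → (c : ℤ) → ∣ K ∣ ℕ.≤ 4 → ∣ L ∣ ℕ.≤ 4 →
                 x ≡ c + K mod t → y ≡ c + L mod t → Close t x y → Near K L
    close⇒near {x} {y} {K} {L} t≥11 c ∣K∣≤4 ∣L∣≤4 x≈c+K y≈c+L (close d y≈x+d) =
      near d (mod-small⇒≡ (mod-cancelˡ c (mod-trans (mod-sym y≈c+L) (offset-step c K (shift d) x≈c+K y≈x+d)))
                          bound)
      where
      open ℕP.≤-Reasoning
      bound : ∣ L - (K + shift d) ∣ ℕ.< t
      bound = begin-strict
        ∣ L - (K + shift d) ∣          ≤⟨ ℤP.∣i-j∣≤∣i∣+∣j∣ L (K + shift d) ⟩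
        ∣ L ∣ ℕ.+ ∣ K + shift d ∣
          ≤⟨ ℕP.+-monoʳ-≤ ∣ L ∣ (ℤP.∣i+j∣≤∣i∣+∣j∣ K (shift d)) ⟩
        ∣ L ∣ ℕ.+ (∣ K ∣ ℕ.+ ∣ shift d ∣)
          ≤⟨ ℕP.+-mono-≤ ∣L∣≤4 (ℕP.+-mono-≤ ∣K∣≤4 (∣shift∣≤2 d)) ⟩
        10                             <⟨ t≥11 ⟩
        t                              ∎

  -- The colours of ac, ad, bc, bd are that of ab shifted by δac, δad, δbc, δbd, and those of cx, dx
  -- are the colours of ac, ad shifted by δcx, δdx; listed are the remaining closeness constraints.
  offset-constraints : (δac δad δbc δbd δcx δdx : Fin 4) → List (ℤ × ℤ)
  offset-constraints δac δad δbc δbd δcx δdx =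
    (ac , ad) ∷ (bc , bd) ∷ (ac , bc) ∷ (bc , cx) ∷ (ad , bd) ∷ (bd , dx) ∷ (cx , dx) ∷ []
    where
    ac = shift δac
    ad = shift δad
    bc = shift δbc
    bd = shift δbd
    cx = ac + shift δcx
    dx = ad + shift δdx

  no-consistent-offsets : ∀ δac δad δbc δbd δcx δdx →
                          ¬ All (uncurry Near) (offset-constraints δac δad δbc δbd δcx δdx)
  no-consistent-offsets = toWitness
    {a? = all? λ δac → all? λ δad → all? λ δbc → all? λ δbd → all? λ δcx → all? λ δdx →
          ¬? (All.all? (uncurry near?) (offset-constraints δac δad δbc δbd δcx δdx))} _
    where open FP using (all?)

  gadget-not-close : ∀ {t ab ac ad bc bd cx dx} → 11 ℕ.≤ t →
    Triangle t ab ac ad → Triangle t ab bc bd → Triangle t ac bc cx → Triangle t ad bd dx → Close t cx dx → ⊥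
  gadget-not-close {t} {ab} t≥11 (close δac ac≈ , close δad ad≈ , ac~ad) (close δbc bc≈ , close δbd bd≈ , bc~bd)
                                 (ac~bc , close δcx cx≈ac+δ , bc~cx) (ad~bd , close δdx dx≈ad+δ , bd~dx) cx~dx =
    no-consistent-offsets δac δad δbc δbd δcx δdx
      ( lift (one δac) (one δad) ac≈ ad≈ ac~ad ∷ lift (one δbc) (one δbd) bc≈ bd≈ bc~bd
      ∷ lift (one δac) (one δbc) ac≈ bc≈ ac~bc ∷ lift (one δbc) (two δac δcx) bc≈ cx≈ bc~cx
      ∷ lift (one δad) (one δbd) ad≈ bd≈ ad~bd ∷ lift (one δbd) (two δad δdx) bd≈ dx≈ bd~dx
      ∷ lift (two δac δcx) (two δad δdx) cx≈ dx≈ cx~dx ∷ [])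
    where
    lift : ∀ {x y K L} → ∣ K ∣ ℕ.≤ 4 → ∣ L ∣ ℕ.≤ 4 →
           x ≡ ab + K mod t → y ≡ ab + L mod t → Close t x y → Near K L
    lift = close⇒near t≥11 ab
    cx≈ = offset-step ab (shift δac) (shift δcx) ac≈ cx≈ac+δ
    dx≈ = offset-step ab (shift δad) (shift δdx) ad≈ dx≈ad+δ
    one : ∀ δ → ∣ shift δ ∣ ℕ.≤ 4
    one δ = ℕP.≤-trans (∣shift∣≤2 δ) (ℕP.m≤m+n 2 2)
    two : ∀ δ δ′ → ∣ shift δ + shift δ′ ∣ ℕ.≤ 4
    two δ δ′ = ℕP.≤-trans (ℤP.∣i+j∣≤∣i∣+∣j∣ (shift δ) (shift δ′))
                          (ℕP.+-mono-≤ (∣shift∣≤2 δ) (∣shift∣≤2 δ′))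

  triangle-resp : ∀ {t x y z x′ y′ z′} → x ≡ x′ → y ≡ y′ → z ≡ z′ →
                  Triangle t x y z → Triangle t x′ y′ z′
  triangle-resp refl refl refl triangle = triangle

open IntegerColours
open import Data.Nat using (_+_; _*_)

NoFourIncreasing : (ℕ → Set) → Set
NoFourIncreasing P = ∀ {a b c d} → a < b → b < c → c < d → P a → P b → P c → P d → ⊥

Convex : (ℕ → Set) → Set
Convex P = ∀ {i j l} → i ≤ j → j ≤ l → P i → P l → P j

CoConvexBelow : ℕ → (ℕ → Set) → Set
CoConvexBelow t P = ∀ {i j l} → i ≤ j → j ≤ l → l < t → ¬ P i → ¬ P l → ¬ P j

module _ {P : ℕ → Set} (no-four : NoFourIncreasing P) where

  convex-gap : Convex P → ∀ {u w} → P u → P w → u < w → w ≤ 2 + u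
  convex-gap convex {u} {w} pu pw u<w with w ≤? 2 + u
  ... | yes w≤2+u = w≤2+u
  ... | no w≰2+u  = ⊥-elim (no-four u<1+u 1+u<2+u 2+u<w pu (inside u<1+u (ℕP.<-trans 1+u<2+u 2+u<w))
                                                          (inside (ℕP.<-trans u<1+u 1+u<2+u) 2+u<w) pw)
    where
    u<1+u = ℕP.n<1+n u
    1+u<2+u = ℕP.n<1+n (1 + u)
    2+u<w = ℕP.≰⇒> w≰2+u
    inside : ∀ {m} → u < m → m < w → P m
    inside u<m m<w = convex (ℕP.<⇒≤ u<m) (ℕP.<⇒≤ m<w) pu pw

  private
    ¬¬-no-four : ∀ {a b c d} → a < b → b < c → c < d → ¬ ¬ P a → ¬ ¬ P b → ¬ ¬ P c → ¬ ¬ P d → ⊥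
    ¬¬-no-four a<b b<c c<d ¬¬pa ¬¬pb ¬¬pc ¬¬pd =
      ¬¬pa λ pa → ¬¬pb λ pb → ¬¬pc λ pc → ¬¬pd λ pd → no-four a<b b<c c<d pa pb pc pd

  module _ {t} (co-convex : CoConvexBelow t P) where

    private
      below : ∀ {u m w y} → P u → u < m → m < w → w < t → ¬ P m → y < u → ¬ ¬ P y
      below pu u<m m<w w<t ¬pm y<u ¬py =
        co-convex (ℕP.<⇒≤ y<u) (ℕP.<⇒≤ u<m) (ℕP.<-trans m<w w<t) ¬py ¬pm pu

      above : ∀ {m w y} → P w → m < w → y < t → ¬ P m → w < y → ¬ ¬ P y
      above pw m<w y<t ¬pm w<y ¬py = co-convex (ℕP.<⇒≤ m<w) (ℕP.<⇒≤ w<y) y<t ¬pm ¬py pw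

      -- A point m strictly between u and w missing from P would put every point outside [u, w]
      -- into P by co-convexity, and as 3 + w ≤ u + t there are at least two of them.
      gap-filled : ∀ u {w m} → P u → P w → u < m → m < w → w < t → 3 + w ≤ u + t → ¬ ¬ P m
      gap-filled (suc (suc u)) pu pw u<m m<w w<t _ ¬pm =
        ¬¬-no-four z<s (s≤s (s≤s z≤n)) (ℕP.<-trans u<m m<w)
          (below pu u<m m<w w<t ¬pm z<s) (below pu u<m m<w w<t ¬pm (s≤s (s≤s z≤n)))
          (λ ¬pu → ¬pu pu) (λ ¬pw → ¬pw pw)
      gap-filled 1 {w} pu pw u<m m<w w<t 3+w≤1+t ¬pm =
        ¬¬-no-four z<s (ℕP.<-trans u<m m<w) (ℕP.n<1+n w)
          (below pu u<m m<w w<t ¬pm z<s) (λ ¬pu → ¬pu pu) (λ ¬pw → ¬pw pw)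
          (above pw m<w (ℕ.s≤s⁻¹ 3+w≤1+t) ¬pm (ℕP.n<1+n w))
      gap-filled 0 {w} pu pw u<m m<w w<t 3+w≤t ¬pm =
        ¬¬-no-four (ℕP.<-trans u<m m<w) (ℕP.n<1+n w) (ℕP.n<1+n (1 + w))
          (λ ¬pu → ¬pu pu) (λ ¬pw → ¬pw pw)
          (above pw m<w (ℕP.<-trans (ℕP.n<1+n (1 + w)) 3+w≤t) ¬pm (ℕP.n<1+n w))
          (above pw m<w 3+w≤t ¬pm (ℕP.<-trans (ℕP.n<1+n w) (ℕP.n<1+n (1 + w))))

    co-convex-gap : ∀ {u w} → P u → P w → u < w → w < t → w ≤ 2 + u ⊎ u + t ≤ 2 + w
    co-convex-gap {u} {w} pu pw u<w w<t with w ≤? 2 + u | u + t ≤? 2 + w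
    ... | yes w≤2+u | _         = inj₁ w≤2+u
    ... | no _      | yes wraps = inj₂ wraps
    ... | no w≰2+u  | no ¬wraps = ⊥-elim (¬¬-no-four u<1+u 1+u<2+u 2+u<w (λ ¬pu → ¬pu pu)
        (gap-filled u pu pw u<1+u (ℕP.<-trans 1+u<2+u 2+u<w) w<t 3+w≤u+t)
        (gap-filled u pu pw (ℕP.<-trans u<1+u 1+u<2+u) 2+u<w w<t 3+w≤u+t) (λ ¬pw → ¬pw pw))
      where
      u<1+u = ℕP.n<1+n u
      1+u<2+u = ℕP.n<1+n (1 + u)
      2+u<w = ℕP.≰⇒> w≰2+u
      3+w≤u+t = ℕP.≰⇒> ¬wraps

toℤ : ∀ {t} → Fin t → ℤ
toℤ i = + toℕ i

one-or-two : ∀ {m n} → m < n → n ≤ 2 + m → n ≡ 1 + m ⊎ n ≡ 2 + m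
one-or-two m<n n≤2+m with ℕP.m≤n⇒m<n∨m≡n n≤2+m
... | inj₁ n<2+m = inj₁ (ℕP.≤-antisym (ℕ.s≤s⁻¹ n<2+m) m<n)
... | inj₂ n≡2+m = inj₂ n≡2+m

near-successor : ∀ {m n} → n ≡ 1 + m ⊎ n ≡ 2 + m → Near (+ m) (+ n)
near-successor {m} (inj₁ refl) = near 0F (cong +_ (ℕP.+-comm 1 m))
near-successor {m} (inj₂ refl) = near 1F (cong +_ (ℕP.+-comm 2 m))

near⇒close : ∀ {t x y} → Near x y → Close t x y
near⇒close (near d y≡x+d) = close d (≡⇒≡-mod y≡x+d)

near-wrap⇒close : ∀ {t m n} → Near (+ m) (+ (n + t)) → Close t (+ m) (+ n)
near-wrap⇒close {t} {m} {n} (near d n+t≡m+d) = close d (mod-trans (mod-sym (+t≡-mod (+ n))) (≡⇒≡-mod n+t≡m+d))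

module _ {t : ℕ} (S : Fin t → Set) where

  Indices : ℕ → Set
  Indices m = ∃ λ i → toℕ i ≡ m × S i

  interval⇒convex : Interval S → Convex Indices
  interval⇒convex interval {j = j} i≤j j≤l (a , refl , sa) (c , refl , sc) =
    b , FP.toℕ-fromℕ< j<t , interval a b c (subst (toℕ a ≤_) (sym (FP.toℕ-fromℕ< j<t)) i≤j)
                                           (subst (_≤ toℕ c) (sym (FP.toℕ-fromℕ< j<t)) j≤l) sa sc
    where
    j<t = ℕP.≤-<-trans j≤l (FP.toℕ<n c)
    b = fromℕ< j<t

  co-interval⇒co-convex : Interval (λ i → ¬ S i) → CoConvexBelow t Indices
  co-interval⇒co-convex co-interval {i} {l = l} i≤j j≤l l<t ¬Pi ¬Pl (b , refl , sb) =
    co-interval a b c (subst (_≤ toℕ b) (sym (FP.toℕ-fromℕ< i<t)) i≤j)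
                      (subst (toℕ b ≤_) (sym (FP.toℕ-fromℕ< l<t)) j≤l)
      (λ sa → ¬Pi (a , FP.toℕ-fromℕ< i<t , sa)) (λ sc → ¬Pl (c , FP.toℕ-fromℕ< l<t , sc)) sb
    where
    i<t = ℕP.≤-<-trans i≤j (FP.toℕ<n b)
    a = fromℕ< i<t
    c = fromℕ< l<t

module _ {a b c d : ℕ} (a<b : a < b) (b<c : b < c) (c<d : c < d) where

  private
    chain-increasing : ∀ {x y} → x F.< y → lookup (a ∷ b ∷ c ∷ d ∷ []) x < lookup (a ∷ b ∷ c ∷ d ∷ []) y
    chain-increasing {0F} {1F} _ = a<b
    chain-increasing {0F} {2F} _ = ℕP.<-trans a<b b<c
    chain-increasing {0F} {3F} _ = ℕP.<-trans a<b (ℕP.<-trans b<c c<d)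
    chain-increasing {1F} {2F} _ = b<c
    chain-increasing {1F} {3F} _ = ℕP.<-trans b<c c<d
    chain-increasing {2F} {3F} _ = c<d
    chain-increasing {_}  {0F} ()
    chain-increasing {1F} {1F} (s≤s ())
    chain-increasing {2F} {1F} (s≤s ())
    chain-increasing {3F} {1F} (s≤s ())
    chain-increasing {2F} {2F} (s≤s (s≤s ()))
    chain-increasing {3F} {2F} (s≤s (s≤s ()))
    chain-increasing {3F} {3F} (s≤s (s≤s (s≤s ())))

  increasing-four-injective : ∀ {x y} →
                              lookup (a ∷ b ∷ c ∷ d ∷ []) x ≡ lookup (a ∷ b ∷ c ∷ d ∷ []) y → x ≡ y
  increasing-four-injective {x} {y} eq with FP.<-cmp x y
  ... | tri< x<y _ _ = ⊥-elim (ℕP.<⇒≢ (chain-increasing x<y) eq)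
  ... | tri≈ _ x≡y _ = x≡y
  ... | tri> _ _ y<x = ⊥-elim (ℕP.<⇒≢ (chain-increasing y<x) (sym eq))

module _ {t : ℕ} {S : Fin t → Set} where

  three-values⇒no-four : (c : Fin 3 → Fin t) → (∀ {i} → S i → ∃ λ k → c k ≡ i) →
                         NoFourIncreasing (Indices S)
  three-values⇒no-four c covers {a} {b} {x} {d} a<b b<x x<d pa pb px pd =
    ℕP.1+n≰n (FP.injective⇒≤ preimage-injective)
    where
    member : ∀ y → Indices S (lookup (a ∷ b ∷ x ∷ d ∷ []) y)
    member 0F = pa
    member 1F = pb
    member 2F = px
    member 3F = pd
    preimage : Fin 4 → Fin 3
    preimage y = proj₁ (covers (proj₂ (proj₂ (member y))))
    lands : ∀ y → toℕ (c (preimage y)) ≡ lookup (a ∷ b ∷ x ∷ d ∷ []) y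
    lands y = trans (cong toℕ (proj₂ (covers (proj₂ (proj₂ (member y)))))) (proj₁ (proj₂ (member y)))
    preimage-injective : ∀ {y z} → preimage y ≡ preimage z → y ≡ z
    preimage-injective {y} {z} eq =
      increasing-four-injective a<b b<x x<d (trans (sym (lands y)) (trans (cong (toℕ ∘ c) eq) (lands z)))

module _ {t : ℕ} {S : Fin t → Set} (cyclic : CyclicInterval S)
         (c : Fin 3 → Fin t) (covers : ∀ {i} → S i → ∃ λ k → c k ≡ i) where

  private
    no-four : NoFourIncreasing (Indices S)
    no-four = three-values⇒no-four c covers

    close-increasing : ∀ {u w} → S u → S w → toℕ u < toℕ w → Close t (toℤ u) (toℤ w)
    close-increasing {u} {w} su sw u<w = [ from-interval , from-co-interval ]′ cyclic
      where
      pu : Indices S (toℕ u)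
      pu = u , refl , su
      pw : Indices S (toℕ w)
      pw = w , refl , sw
      from-interval : Interval S → Close t (toℤ u) (toℤ w)
      from-interval interval =
        near⇒close (near-successor (one-or-two u<w (convex-gap no-four (interval⇒convex S interval) pu pw u<w)))
      from-co-interval : Interval (λ i → ¬ S i) → Close t (toℤ u) (toℤ w)
      from-co-interval co-interval
        with co-convex-gap no-four (co-interval⇒co-convex S co-interval) pu pw u<w (FP.toℕ<n w)
      ... | inj₁ w≤2+u = near⇒close (near-successor (one-or-two u<w w≤2+u))
      ... | inj₂ wraps = close-sym (near-wrap⇒close (near-successor (one-or-two w<u+t wraps)))
        where w<u+t = ℕP.<-≤-trans (FP.toℕ<n w) (ℕP.m≤n+m t (toℕ u))

  close-in-cyclic-interval : ∀ {u w} → S u → S w → u ≢ w → Close t (toℤ u) (toℤ w)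
  close-in-cyclic-interval {u} {w} su sw u≢w with ℕP.<-cmp (toℕ u) (toℕ w)
  ... | tri< u<w _ _ = close-increasing su sw u<w
  ... | tri≈ _ u≡w _ = ⊥-elim (u≢w (FP.toℕ-injective u≡w))
  ... | tri> _ _ w<u = close-sym (close-increasing sw su w<u)

module _ {G : Graph} where

  E-sym : ∀ {u w} → E G u w → E G w u
  E-sym {u} {w} = subst T (Graph.sym G u w)

  infixr 5 _++ʷ_

  _++ʷ_ : ∀ {u w v} → Walk G u w → Walk G w v → Walk G u v
  here       ++ʷ q = q
  step e p   ++ʷ q = step e (p ++ʷ q)

  reverseʷ : ∀ {u v} → Walk G u v → Walk G v u
  reverseʷ here       = here
  reverseʷ (step e p) = reverseʷ p ++ʷ step (E-sym e) here

  connected-via : (c : Fin (V G)) → (∀ u → Walk G u c) → Connected G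
  connected-via c to-c u v = to-c u ++ʷ reverseʷ (to-c v)

private
  preds : ∀ {m} → List (Fin (suc m)) → List (Fin m)
  preds []           = []
  preds (F.zero ∷ xs)  = preds xs
  preds (F.suc x ∷ xs) = x ∷ preds xs

  suc∈⇒∈preds : ∀ {m} {u : Fin m} (xs : List (Fin (suc m))) → F.suc u ∈ xs → u ∈ preds xs
  suc∈⇒∈preds (F.zero ∷ xs)  (there p)   = suc∈⇒∈preds xs p
  suc∈⇒∈preds (F.suc x ∷ xs) (here refl) = here refl
  suc∈⇒∈preds (F.suc x ∷ xs) (there p)   = there (suc∈⇒∈preds xs p)

  length-preds : ∀ {m} (xs : List (Fin (suc m))) → length (preds xs) ≤ length xs
  length-preds []             = z≤n
  length-preds (F.zero ∷ xs)  = ℕP.m≤n⇒m≤1+n (length-preds xs)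
  length-preds (F.suc x ∷ xs) = s≤s (length-preds xs)

  0∈⇒length-preds< : ∀ {m} (xs : List (Fin (suc m))) → F.zero ∈ xs → length (preds xs) < length xs
  0∈⇒length-preds< (F.zero ∷ xs)  _         = s≤s (length-preds xs)
  0∈⇒length-preds< (F.suc x ∷ xs) (there p) = s≤s (0∈⇒length-preds< xs p)

  count-tabulate≤length : ∀ m (f : Fin m → Bool) (xs : List (Fin m)) → (∀ u → T (f u) → u ∈ xs) →
                          sum (tabulate (λ u → if f u then 1 else 0)) ≤ length xs
  count-tabulate≤length zero    f xs covered = z≤n
  count-tabulate≤length (suc m) f xs covered
    with f F.zero in f0
       | count-tabulate≤length m (f ∘ F.suc) (preds xs) (λ u fu → suc∈⇒∈preds xs (covered (F.suc u) fu))
  ... | true  | rest = ℕP.≤-trans (s≤s rest) (0∈⇒length-preds< xs (covered F.zero (subst T (sym f0) tt)))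
  ... | false | rest = ℕP.≤-trans rest (length-preds xs)

degree≤length : ∀ (G : Graph) v (xs : List (Fin (V G))) → (∀ u → E G v u → u ∈ xs) → degree G v ≤ length xs
degree≤length G v xs covered =
  subst (_≤ length xs) (cong sum (sym (map-tabulate (λ u → u) (λ u → if adj G v u then 1 else 0))))
        (count-tabulate≤length (V G) (adj G v) xs covered)

module _ (G : Graph) (k : ℕ) (f : Fin k → Fin (V G)) where

  old : Fin (V G) → Fin (V (attach G k f))
  old x = x ↑ˡ k

  attach-adj-old : ∀ x y → adj (attach G k f) (old x) (old y) ≡ adj G x y
  attach-adj-old x y = cong₂ (adj⊎ (V G) k f (adj G)) (FP.splitAt-↑ˡ (V G) x k) (FP.splitAt-↑ˡ (V G) y k)

  attach-E-old : ∀ {x y} → E G x y → E (attach G k f) (old x) (old y)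
  attach-E-old {x} {y} = subst T (sym (attach-adj-old x y))

  old-injective : ∀ {x y} → old x ≡ old y → x ≡ y
  old-injective = FP.↑ˡ-injective k _ _

  attach-neighbour-of-untouched : ∀ {x y} → (∀ j → f j ≢ x) → E (attach G k f) (old x) y →
                                  ∃ λ y₀ → y ≡ old y₀ × E G x y₀
  attach-neighbour-of-untouched {x} {y} untouched e with splitAt (V G) y in split-y
  ... | inj₁ y₀ = y₀ , sym (FP.splitAt⁻¹-↑ˡ split-y) , e′
    where e′ = subst (λ s → T (adj⊎ (V G) k f (adj G) s (inj₁ y₀))) (FP.splitAt-↑ˡ (V G) x k) e
  ... | inj₂ j with x F.≟ f j | subst (λ s → T (adj⊎ (V G) k f (adj G) s (inj₂ j))) (FP.splitAt-↑ˡ (V G) x k) e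
  ...   | yes x≡fj | _ = ⊥-elim (untouched j (sym x≡fj))
  ...   | no _     | ()

module _ {G : Graph} {t : ℕ} (α : ProperEdgeColoring G t) (v : Fin (V G)) where

  neighbours≤colours : ∀ {k} (ν : Fin k → Fin (V G)) → (∀ i → E G v (ν i)) →
                       (∀ {i j} → ν i ≡ ν j → i ≡ j) → k ≤ t
  neighbours≤colours ν adjacent ν-injective = FP.injective⇒≤ λ {i} {j} same-colour →
    ν-injective (proper α v (ν i) (ν j) (adjacent i) (adjacent j) same-colour)

  degree-three-triangle : IsCyclicIntervalColoring α → (ν : Fin 3 → Fin (V G)) →
    (∀ i → E G v (ν i)) → (∀ {i j} → ν i ≡ ν j → i ≡ j) → (∀ y → E G v y → ∃ λ i → ν i ≡ y) →
    Triangle t (toℤ (col α v (ν 0F))) (toℤ (col α v (ν 1F))) (toℤ (col α v (ν 2F)))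
  degree-three-triangle cyclic ν adjacent ν-injective exhaustive =
    close-pair 0F 1F (λ ()) , close-pair 0F 2F (λ ()) , close-pair 1F 2F (λ ())
    where
    c : Fin 3 → Fin t
    c i = col α v (ν i)
    covers : ∀ {colour} → ColorsAt α v colour → ∃ λ i → c i ≡ colour
    covers (y , v~y , refl) with exhaustive y v~y
    ... | i , refl = i , refl
    close-pair : ∀ i j → i ≢ j → Close t (toℤ (c i)) (toℤ (c j))
    close-pair i j i≢j = close-in-cyclic-interval (cyclic v) c covers (ν i , adjacent i , refl) (ν j , adjacent j , refl)
      (λ same-colour → i≢j (ν-injective (proper α v (ν i) (ν j) (adjacent i) (adjacent j) same-colour)))

does⇒ : ∀ {P : Set} (p? : Dec P) → T (does p?) → P
does⇒ (yes p) _ = p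

⇒does : ∀ {P : Set} (p? : Dec P) → P → T (does p?)
⇒does (yes _) _ = tt
⇒does (no ¬p) p = ¬p p

-- Inside a block: 0, 1, 2, 3, 4 are the gadget vertices a, b, c, d, x, then 5–14 are leaves
-- and 15 is the hub, adjacent to x and to the leaves.
block-edge : ℕ → ℕ → Bool
block-edge 0 1 = true
block-edge 0 2 = true
block-edge 0 3 = true
block-edge 1 2 = true
block-edge 1 3 = true
block-edge 2 4 = true
block-edge 3 4 = true
block-edge m 15 = (4 ℕ.≤ᵇ m) ∧ (m ℕ.≤ᵇ 14)
block-edge _ _ = false

block-adj : Fin 16 → Fin 16 → Bool
block-adj i j = block-edge (toℕ i) (toℕ j) ∨ block-edge (toℕ j) (toℕ i)

va vb vc vd vx hub : Fin 16
va = F.# 0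
vb = F.# 1
vc = F.# 2
vd = F.# 3
vx = F.# 4
hub = F.# 15

is-hub : Fin 16 → Bool
is-hub i = does (i F.≟ hub)

module _ (n : ℕ) where

  consecutive : Fin n → Fin n → Bool
  consecutive b b′ = does (toℕ b′ ℕ.≟ suc (toℕ b))

  chain-adj : Fin n × Fin 16 → Fin n × Fin 16 → Bool
  chain-adj (b , i) (b′ , j) =
    if does (b F.≟ b′) then block-adj i j else (is-hub i ∧ is-hub j ∧ (consecutive b b′ ∨ consecutive b′ b))

  private
    ∧-swap : ∀ x y {z w} → z ≡ w → x ∧ y ∧ z ≡ y ∧ x ∧ w
    ∧-swap true  true  z≡w = z≡w
    ∧-swap true  false _   = refl
    ∧-swap false true  _   = refl
    ∧-swap false false _   = refl

    chain-adj-sym : ∀ p q → chain-adj p q ≡ chain-adj q p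
    chain-adj-sym (b , i) (b′ , j) with b F.≟ b′ | b′ F.≟ b
    ... | yes _    | yes _    = ∨-comm (block-edge (toℕ i) (toℕ j)) _
    ... | yes b≡b′ | no b′≢b  = ⊥-elim (b′≢b (sym b≡b′))
    ... | no b≢b′  | yes b′≡b = ⊥-elim (b≢b′ (sym b′≡b))
    ... | no _     | no _     = ∧-swap (is-hub i) (is-hub j) (∨-comm (consecutive b b′) _)

    chain-adj-irrefl : ∀ p → chain-adj p p ≡ false
    chain-adj-irrefl (b , i) with b F.≟ b
    ... | yes _  = toWitness {a? = FP.all? λ i → block-adj i i Bool.≟ false} tt i
    ... | no b≢b = ⊥-elim (b≢b refl)

  block-chain : Graph
  block-chain = record
    { V      = n * 16
    ; adj    = λ u v → chain-adj (remQuot 16 u) (remQuot 16 v)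
    ; sym    = λ u v → chain-adj-sym (remQuot 16 u) (remQuot 16 v)
    ; irrefl = λ u → chain-adj-irrefl (remQuot 16 u)
    }

local-neighbours : Fin 16 → List (Fin 16)
local-neighbours i = filter (T? ∘ block-adj i) (allFin 16)

length-local-neighbours : ∀ i → length (local-neighbours i) ≤ 11
length-local-neighbours = toWitness {a? = FP.all? λ i → length (local-neighbours i) ℕ.≤? 11} tt

∈-local-neighbours : ∀ {i j} → T (block-adj i j) → j ∈ local-neighbours i
∈-local-neighbours {i} {j} = ∈-filter⁺ (T? ∘ block-adj i) (∈-allFin j)

previous : ∀ {m} → Fin m → List (Fin m)
previous F.zero    = []
previous (F.suc b) = F.inject₁ b ∷ []

length-previous : ∀ {m} (b : Fin m) → length (previous b) ≤ 1
length-previous F.zero    = z≤n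
length-previous (F.suc b) = s≤s z≤n

∈-previous : ∀ {m} {b b′ : Fin m} → toℕ b ≡ suc (toℕ b′) → b′ ∈ previous b
∈-previous {b = F.suc b} eq = here (FP.toℕ-injective (trans (ℕP.suc-injective (sym eq)) (sym (FP.toℕ-inject₁ b))))

module _ {n : ℕ} where

  next : Fin n → List (Fin n)
  next b with suc (toℕ b) ℕ.<? n
  ... | yes b+1<n = fromℕ< b+1<n ∷ []
  ... | no _      = []

  length-next : ∀ b → length (next b) ≤ 1
  length-next b with suc (toℕ b) ℕ.<? n
  ... | yes _ = s≤s z≤n
  ... | no _  = z≤n

  ∈-next : ∀ {b b′} → toℕ b′ ≡ suc (toℕ b) → b′ ∈ next b
  ∈-next {b} {b′} eq with suc (toℕ b) ℕ.<? n
  ... | yes b+1<n = here (FP.toℕ-injective (trans eq (sym (FP.toℕ-fromℕ< b+1<n))))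
  ... | no b+1≮n  = ⊥-elim (b+1≮n (subst (ℕ._< n) eq (FP.toℕ<n b′)))

  chain-neighbours : Fin n × Fin 16 → List (Fin (n * 16))
  chain-neighbours (b , i) =
    map (combine b) (local-neighbours i) ++ map (λ b′ → combine b′ hub) (next b ++ previous b)

  length-chain-neighbours : ∀ p → length (chain-neighbours p) ≤ 13
  length-chain-neighbours (b , i)
    rewrite length-++ (map (combine b) (local-neighbours i)) {map (λ b′ → combine b′ hub) (next b ++ previous b)}
          | length-map (combine b) (local-neighbours i)
          | length-map (λ b′ → combine b′ hub) (next b ++ previous b)
          | length-++ (next b) {previous b}
    = ℕP.+-mono-≤ (length-local-neighbours i) (ℕP.+-mono-≤ (length-next b) (length-previous b))

  hub-link : ∀ {b b′ i j} → T (is-hub i ∧ is-hub j ∧ (consecutive n b b′ ∨ consecutive n b′ b)) →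
             i ≡ hub × j ≡ hub × (toℕ b′ ≡ suc (toℕ b) ⊎ toℕ b ≡ suc (toℕ b′))
  hub-link {b} {b′} {i} {j} e with Equivalence.to (T-∧ {is-hub i}) e
  ...   | i-hub , e′ with Equivalence.to (T-∧ {is-hub j}) e′
  ...     | j-hub , linked =
    does⇒ (i F.≟ hub) i-hub , does⇒ (j F.≟ hub) j-hub ,
    Sum.map (does⇒ (_ ℕ.≟ _)) (does⇒ (_ ℕ.≟ _)) (Equivalence.to (T-∨ {consecutive n b b′}) linked)

  chain-neighbours-complete : ∀ p q → T (chain-adj n p q) → uncurry combine q ∈ chain-neighbours p
  chain-neighbours-complete (b , i) (b′ , j) e with b F.≟ b′
  ... | yes refl = ∈-++⁺ˡ (∈-map⁺ (combine b) (∈-local-neighbours e))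
  ... | no _ with hub-link {b} {b′} {i} {j} e
  ...   | _ , refl , linked =
    ∈-++⁺ʳ (map (combine b) (local-neighbours i)) (∈-map⁺ (λ b′ → combine b′ hub) neighbour-block)
    where
    neighbour-block : b′ ∈ next b ++ previous b
    neighbour-block = [ ∈-++⁺ˡ ∘ ∈-next , ∈-++⁺ʳ (next b) ∘ ∈-previous ]′ linked

  block-chain-max-degree : MaxDegreeAtMost (block-chain n) 13
  block-chain-max-degree v = ℕP.≤-trans (degree≤length (block-chain n) v (chain-neighbours (remQuot 16 v)) complete)
                                         (length-chain-neighbours (remQuot 16 v))
    where
    complete : ∀ u → E (block-chain n) v u → u ∈ chain-neighbours (remQuot 16 v)
    complete u e = subst (_∈ chain-neighbours (remQuot 16 v)) (FP.combine-remQuot {n} 16 u)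
                         (chain-neighbours-complete (remQuot 16 v) (remQuot 16 u) e)

towards-hub : Fin 16 → Fin 16
towards-hub i with toℕ i
... | 0 = vc
... | 1 = vc
... | 2 = vx
... | 3 = vx
... | _ = hub

towards-hub-stays-or-steps : ∀ i → i ≡ towards-hub i ⊎ T (block-adj i (towards-hub i))
towards-hub-stays-or-steps =
  toWitness {a? = FP.all? λ i → (i F.≟ towards-hub i) ⊎-dec T? (block-adj i (towards-hub i))} tt

towards-hub³≡hub : ∀ i → towards-hub (towards-hub (towards-hub i)) ≡ hub
towards-hub³≡hub = toWitness {a? = FP.all? λ i → towards-hub (towards-hub (towards-hub i)) F.≟ hub} tt

module _ {n : ℕ} where

  chain-adj-combine : ∀ b i b′ j →
                      adj (block-chain n) (combine b i) (combine b′ j) ≡ chain-adj n (b , i) (b′ , j)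
  chain-adj-combine b i b′ j = cong₂ (chain-adj n) (FP.remQuot-combine b i) (FP.remQuot-combine b′ j)

  block-edge⇒chain-edge : ∀ b i j → T (block-adj i j) → E (block-chain n) (combine b i) (combine b j)
  block-edge⇒chain-edge b i j e = subst T (sym (chain-adj-combine b i b j)) (same-block e)
    where
    same-block : T (block-adj i j) → T (chain-adj n (b , i) (b , j))
    same-block with b F.≟ b
    ... | yes _  = λ e → e
    ... | no b≢b = ⊥-elim (b≢b refl)

  hub-edge : ∀ b b′ → toℕ b ≡ suc (toℕ b′) → E (block-chain n) (combine b hub) (combine b′ hub)
  hub-edge b b′ b≡1+b′ = subst T (sym (chain-adj-combine b hub b′ hub)) different-blocks
    where
    different-blocks : T (chain-adj n (b , hub) (b′ , hub))
    different-blocks with b F.≟ b′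
    ... | yes refl = ⊥-elim (ℕP.1+n≢n (sym b≡1+b′))
    ... | no _     =
      Equivalence.from (T-∨ {consecutive n b b′}) (inj₂ (⇒does (toℕ b ℕ.≟ suc (toℕ b′)) b≡1+b′))

  walk-to-own-hub : ∀ b i → Walk (block-chain n) (combine b i) (combine b hub)
  walk-to-own-hub b i = subst (λ h → Walk (block-chain n) (combine b i) (combine b h)) (towards-hub³≡hub i)
    (one-step i ++ʷ one-step (towards-hub i) ++ʷ one-step (towards-hub (towards-hub i)))
    where
    one-step : ∀ j → Walk (block-chain n) (combine b j) (combine b (towards-hub j))
    one-step j with towards-hub-stays-or-steps j
    ... | inj₁ j≡next = subst (λ h → Walk (block-chain n) (combine b j) (combine b h)) j≡next here
    ... | inj₂ e      = step (block-edge⇒chain-edge b j (towards-hub j) e) here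

module _ (m : ℕ) where

  first-hub : Fin (suc m * 16)
  first-hub = combine {suc m} F.zero hub

  walk-along-hubs : ∀ k (k<n : k < suc m) → Walk (block-chain (suc m)) (combine (fromℕ< k<n) hub) first-hub
  walk-along-hubs zero    _     = here
  walk-along-hubs (suc k) k+1<n = step (hub-edge (fromℕ< k+1<n) (fromℕ< k<n) consecutive-blocks) (walk-along-hubs k k<n)
    where
    k<n = ℕP.<-trans (ℕP.n<1+n k) k+1<n
    consecutive-blocks = trans (FP.toℕ-fromℕ< k+1<n) (cong suc (sym (FP.toℕ-fromℕ< k<n)))

  walk-to-first-hub : ∀ u → Walk (block-chain (suc m)) u first-hub
  walk-to-first-hub u = subst (λ v → Walk (block-chain (suc m)) v first-hub) (FP.combine-remQuot {suc m} 16 u)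
    (walk-to-own-hub b i ++ʷ along-hubs)
    where
    b = proj₁ (remQuot {suc m} 16 u)
    i = proj₂ (remQuot {suc m} 16 u)
    along-hubs : Walk (block-chain (suc m)) (combine b hub) first-hub
    along-hubs = subst (λ c → Walk (block-chain (suc m)) (combine c hub) first-hub) (FP.fromℕ<-toℕ b (FP.toℕ<n b))
                       (walk-along-hubs (toℕ b) (FP.toℕ<n b))

  block-chain-connected : Connected (block-chain (suc m))
  block-chain-connected = connected-via first-hub walk-to-first-hub

missed-by : ∀ {k n} → k < n → (g : Fin k → Fin n) → ∃ λ b → ∀ j → g j ≢ b
missed-by {k} {n} k<n g with FP.¬∀⟶∃¬ n _ (λ b → FP.any? λ j → g j F.≟ b) not-onto
  where
  not-onto : ¬ (∀ b → ∃ λ j → g j ≡ b)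
  not-onto onto = ℕP.<⇒≱ k<n (FP.injective⇒≤ {f = proj₁ ∘ onto} λ {b} {b′} same →
                    trans (sym (proj₂ (onto b))) (trans (cong g same) (proj₂ (onto b′))))
... | b , not-hit = b , λ j gj≡b → not-hit (j , gj≡b)

ExactNeighbours : Fin 16 → (Fin 3 → Fin 16) → Set
ExactNeighbours l ν = (∀ i → T (block-adj l (ν i))) × (∀ i j → ν i ≡ ν j → i ≡ j) ×
                      (∀ j → T (block-adj l j) → ∃ λ i → ν i ≡ j)

exact-neighbours? : ∀ l ν → Dec (ExactNeighbours l ν)
exact-neighbours? l ν = FP.all? (λ i → T? (block-adj l (ν i)))
  ×-dec FP.all? (λ i → FP.all? λ j → (ν i F.≟ ν j) →-dec (i F.≟ j))
  ×-dec FP.all? (λ j → T? (block-adj l j) →-dec FP.any? λ i → ν i F.≟ j)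

hub-neighbour : Fin 11 → Fin 16
hub-neighbour i = 4 ↑ʳ (i ↑ˡ 1)

hub-neighbour-adjacent : ∀ i → T (block-adj hub (hub-neighbour i))
hub-neighbour-adjacent = toWitness {a? = FP.all? λ i → T? (block-adj hub (hub-neighbour i))} tt

hub-neighbour-injective : ∀ {i j} → hub-neighbour i ≡ hub-neighbour j → i ≡ j
hub-neighbour-injective {i} {j} = FP.↑ˡ-injective 1 i j ∘ FP.↑ʳ-injective 4 _ _

module _ {n : ℕ} where

  non-hub-edge-in-block : ∀ {b l b′ j} → l ≢ hub → T (chain-adj n (b , l) (b′ , j)) →
                          b ≡ b′ × T (block-adj l j)
  non-hub-edge-in-block {b} {l} {b′} {j} l≢hub e with b F.≟ b′
  ... | yes b≡b′ = b≡b′ , e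
  ... | no _     = ⊥-elim (l≢hub (proj₁ (hub-link {b = b} {b′} {l} {j} e)))

  neighbour-in-own-block : ∀ b l {y} → l ≢ hub → E (block-chain n) (combine b l) y →
                           ∃ λ j → y ≡ combine b j × T (block-adj l j)
  neighbour-in-own-block b l {y} l≢hub e with non-hub-edge-in-block l≢hub e′
    where
    e′ : T (chain-adj n (b , l) (remQuot 16 y))
    e′ = subst (λ p → T (chain-adj n p (remQuot 16 y))) (FP.remQuot-combine b l) e
  ... | b≡b′ , l~j =
    proj₂ (remQuot {n} 16 y) , trans (sym (FP.combine-remQuot {n} 16 y)) (cong (λ c → combine c _) (sym b≡b′)) , l~j

module _ (m : ℕ) {k : ℕ} (f : Fin k → Fin (suc m * 16)) {t : ℕ}
         (α : ProperEdgeColoring (attach (block-chain (suc m)) k f) t) where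

  private
    G = block-chain (suc m)

  position : Fin (suc m) → Fin 16 → Fin (V (attach G k f))
  position b l = old G k f (combine b l)

  private
    position-injective : ∀ b {l l′} → position b l ≡ position b l′ → l ≡ l′
    position-injective b = FP.combine-injectiveʳ b _ b _ ∘ old-injective G k f

    position-edge : ∀ b l l′ → T (block-adj l l′) → E (attach G k f) (position b l) (position b l′)
    position-edge b l l′ = attach-E-old G k f {combine b l} {combine b l′} ∘ block-edge⇒chain-edge b l l′

  11≤colours : 11 ≤ t
  11≤colours = neighbours≤colours α (position F.zero hub) (position F.zero ∘ hub-neighbour)
    (λ i → position-edge F.zero hub (hub-neighbour i) (hub-neighbour-adjacent i))
    (hub-neighbour-injective ∘ position-injective F.zero)

  module UntouchedBlock (cyclic : IsCyclicIntervalColoring α) (b : Fin (suc m))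
           (untouched : ∀ j → proj₁ (remQuot {suc m} 16 (f j)) ≢ b) where

    κ : Fin 16 → Fin 16 → ℤ
    κ l l′ = toℤ (col α (position b l) (position b l′))

    κ-sym : ∀ l l′ → T (block-adj l l′) → κ l l′ ≡ κ l′ l
    κ-sym l l′ e = cong toℤ (col-sym α (position b l) (position b l′) (position-edge b l l′ e))

    gadget-vertex-triangle : ∀ l x y z → l ≢ hub → {_ : True (exact-neighbours? l (lookup (x ∷ y ∷ z ∷ [])))} →
                             Triangle t (κ l x) (κ l y) (κ l z)
    gadget-vertex-triangle l x y z l≢hub {exact} =
      degree-three-triangle α (position b l) cyclic (position b ∘ ν) (λ i → position-edge b l (ν i) (adjacent i))
        (λ same → injective _ _ (position-injective b same)) exhaustive′
      where
      ν = lookup (x ∷ y ∷ z ∷ [])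
      neighbours = toWitness exact
      adjacent = proj₁ neighbours
      injective = proj₁ (proj₂ neighbours)
      exhaustive = proj₂ (proj₂ neighbours)
      untouched′ : ∀ j → f j ≢ combine b l
      untouched′ j fj≡bl =
        untouched j (trans (cong (proj₁ ∘ remQuot 16) fj≡bl) (cong proj₁ (FP.remQuot-combine b l)))
      exhaustive′ : ∀ w → E (attach G k f) (position b l) w → ∃ λ i → position b (ν i) ≡ w
      exhaustive′ w e with attach-neighbour-of-untouched G k f {combine b l} {w} untouched′ e
      ... | w₀ , refl , e₀ with neighbour-in-own-block b l {w₀} l≢hub e₀
      ... | j , refl , l~j with exhaustive j l~j
      ... | i , refl = i , refl

block-chain-defc : ∀ m → DefcAtLeast (block-chain (suc m)) (suc m)
block-chain-defc m k k<n f (t , α , cyclic) =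
  gadget-not-close (11≤colours m f α) at-a
    (triangle-resp (κ-sym vb va _) refl refl at-b)
    (triangle-resp (κ-sym vc va _) (κ-sym vc vb _) refl at-c)
    (triangle-resp (κ-sym vd va _) (κ-sym vd vb _) refl at-d)
    (subst₂ (Close t) (κ-sym vx vc _) (κ-sym vx vd _) (proj₁ at-x))
  where
  untouched-block = missed-by k<n (λ j → proj₁ (remQuot {suc m} 16 (f j)))
  open UntouchedBlock m f α cyclic (proj₁ untouched-block) (proj₂ untouched-block)
  at-a = gadget-vertex-triangle va vb vc vd (λ ())
  at-b = gadget-vertex-triangle vb va vc vd (λ ())
  at-c = gadget-vertex-triangle vc va vb vx (λ ())
  at-d = gadget-vertex-triangle vd va vb vx (λ ())
  at-x = gadget-vertex-triangle vx vc vd hub (λ ())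

corollary1 : Σ ℕ λ D → (n : ℕ) → 1 ≤ n →
    Σ Graph λ G → Connected G × MaxDegreeAtMost G D × DefcAtLeast G n
corollary1 = 13 , construction
  where
  construction : (n : ℕ) → 1 ≤ n → Σ Graph λ G → Connected G × MaxDegreeAtMost G 13 × DefcAtLeast G n
  construction (suc m) _ = block-chain (suc m) , block-chain-connected m , block-chain-max-degree , block-chain-defc m
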